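{- Let $A\in\mathcal{A}_n$ be a binary matrix and let $t>0$ be such that \[ \text{for all } 1\le i\le j\le n:\quad 1_{\mathrm{UR}}(i,j)<t \ \text{ or } \ 0_{\mathrm{LL}}(i,j)<t. \] Let $R$ be the symmetric binary $n\times n$ matrix defined, for $1\le i\le j\le n$, by $R_{i,j}=R_{j,i}=0$ if $i=1$ or $j=n$, and otherwise $R_{i,j}=R_{j,i}=1$ if $1_{\mathrm{UR}}(i,j)\ge t$ and $R_{i,j}=R_{j,i}=0$ if $1_{\mathrm{UR}}(i,j)<t$. Then \[ \|A-R\|_1\le\frac{16\sqrt{t}+4}{n}. \]
   Context: For a positive integer $n$, $\mathcal{A}_n$ denotes the set of all symmetric $n\times n$ real matrices with entries in $[0,1]$; a matrix is binary if its entries lie in $\{0,1\}$. The normalized $\ell^1$-norm of an $n\times n$ matrix $A$ is $\|A\|_1=\frac{1}{n^2}\sum_{i,j=1}^n|A_{i,j}|$. For $1\le a\le b\le n$ define the regions $\mathrm{UR}(a,b)=\{(i,j): 1\le i<a,\ b<j\le n\}$ and $\mathrm{LL}(a,b)=\{(i,j): a\le i\le j\le b\}$, and for a binary matrix $A$ let $1_{\mathrm{UR}}(a,b)$ be the number of cells $(i,j)\in\mathrm{UR}(a,b)$ with $A_{i,j}=1$ and $0_{\mathrm{LL}}(a,b)$ the number of cells $(i,j)\in\mathrm{LL}(a,b)$ with $A_{i,j}=0$. (The matrix $R$ described is the output of the paper's Algorithm 1 on input $A$ with threshold $t$.)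
   Formalization: The threshold t is taken over the positive rationals. -}

module Defs where

open import Data.Bool using (Bool; true; false; if_then_else_; _∧_; _xor_; not)
open import Data.Nat using (ℕ; zero; suc; _+_; _≤ᵇ_; _<ᵇ_; _⊓_; _⊔_)
open import Data.Fin using (Fin; toℕ)
open import Data.List using (map; allFin)
open import Data.Nat.ListAction using (sum)
open import Data.Integer using (+_)
open import Data.Rational using (ℚ; _/_)
open import Data.Rational.Properties using (_≤?_)
open import Relation.Nullary using (does)
open import Relation.Binary.PropositionalEquality using (_≡_)

-- A binary n×n matrix, entries indexed by Fin n (entry (i,j) of the paper,
-- with 1-based indices, is  A i j  where  toℕ i = i-1, toℕ j = j-1).
BinMatrix : ℕ → Set
BinMatrix n = Fin n → Fin n → Bool

Symmetric : {n : ℕ} → BinMatrix n → Set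
Symmetric {n} A = (i j : Fin n) → A i j ≡ A j i

idx : {n : ℕ} → Fin n → ℕ
idx i = suc (toℕ i)

countCells : (n : ℕ) → (Fin n → Fin n → Bool) → ℕ
countCells n P =
  sum (map (λ i → sum (map (λ j → if P i j then 1 else 0) (allFin n))) (allFin n))

oneUR : {n : ℕ} → BinMatrix n → ℕ → ℕ → ℕ
oneUR {n} A a b = countCells n (λ i j → (idx i <ᵇ a) ∧ (b <ᵇ idx j) ∧ A i j)

zeroLL : {n : ℕ} → BinMatrix n → ℕ → ℕ → ℕ
zeroLL {n} A a b =
  countCells n (λ i j → (a ≤ᵇ idx i) ∧ (idx i ≤ᵇ idx j) ∧ (idx j ≤ᵇ b) ∧ not (A i j))

ℕtoℚ : ℕ → ℚ
ℕtoℚ k = (+ k) / 1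

Rupper : {n : ℕ} → BinMatrix n → ℚ → ℕ → ℕ → Bool
Rupper {n} A t i j with i ≤ᵇ 1
... | true = false
... | false with n ≤ᵇ j
...   | true = false
...   | false = does (t ≤? ℕtoℚ (oneUR A i j))

Rmat : {n : ℕ} → BinMatrix n → ℚ → BinMatrix n
Rmat A t i j = Rupper A t (idx i ⊓ idx j) (idx i ⊔ idx j)

-- n² · ‖A − R‖₁ = Σ_{i,j} |A_ij − R_ij| = number of cells where A and R differ
diffCount : {n : ℕ} → BinMatrix n → BinMatrix n → ℕ
diffCount {n} A R = countCells n (λ i j → A i j xor R i j)

module Submission where

-- Choose s ∈ ℕ with s² ≤ t ≤ (s+1)².  By symmetry it suffices to count the errors on or
-- above the diagonal; they are 1s of A that R misses and 0s of A that R adds.  A missed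
-- cell has fewer than t ones of A strictly up-right of it, hence fewer than (s+1)² missed
-- cells there; an added cell has, by the hypothesis, fewer than t zeros of A in its
-- lower-left triangle, hence fewer than (s+1)² added cells there.  A staircase counting
-- argument bounds such sets: cells with few cells beside them in their row are few per
-- row, the remaining cells are heavy and therefore few per column.  This gives at most
-- 2(s+1)n missed and 2sn added cells, so D ≤ 4n + 8sn, and (D − 4n)² ≤ 64s²n² ≤ 256tn².

module Counting where

  open import Data.Bool using (Bool; true; false; if_then_else_; _∧_; not; T; _xor_)
  open import Data.Nat
  open import Data.Nat.Properties
  open import Algebra.Properties.CommutativeSemigroup +-commutativeSemigroup using (interchange)
  open import Data.Product using (_×_; _,_; proj₁; proj₂)
  open import Data.Unit using (tt)
  open import Function using (_∘_)
  open import Relation.Binary.PropositionalEquality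
  open import Relation.Nullary using (¬_; contradiction)
  open import Relation.Nullary.Reflects using (ofʸ; ofⁿ)

  ∑ : ℕ → (ℕ → ℕ) → ℕ
  ∑ zero    f = 0
  ∑ (suc n) f = ∑ n f + f n

  𝟙 : Bool → ℕ
  𝟙 b = if b then 1 else 0

  ∑-unfoldˡ : ∀ n f → ∑ (suc n) f ≡ f 0 + ∑ n (f ∘ suc)
  ∑-unfoldˡ zero    f = +-comm 0 (f 0)
  ∑-unfoldˡ (suc n) f = begin
    ∑ n f + f n + f (suc n)               ≡⟨ cong (_+ f (suc n)) (∑-unfoldˡ n f) ⟩
    f 0 + ∑ n (f ∘ suc) + f (suc n)       ≡⟨ +-assoc (f 0) _ _ ⟩
    f 0 + (∑ n (f ∘ suc) + f (suc n))     ∎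
    where open ≡-Reasoning

  ∑-cong : ∀ n {f g} → (∀ k → k < n → f k ≡ g k) → ∑ n f ≡ ∑ n g
  ∑-cong zero    eq = refl
  ∑-cong (suc n) eq = cong₂ _+_ (∑-cong n (λ k k<n → eq k (m<n⇒m<1+n k<n))) (eq n ≤-refl)

  ∑-mono : ∀ n {f g} → (∀ k → k < n → f k ≤ g k) → ∑ n f ≤ ∑ n g
  ∑-mono zero    le = z≤n
  ∑-mono (suc n) le = +-mono-≤ (∑-mono n (λ k k<n → le k (m<n⇒m<1+n k<n))) (le n ≤-refl)

  ∑-+ : ∀ n f g → ∑ n (λ k → f k + g k) ≡ ∑ n f + ∑ n g
  ∑-+ zero    f g = refl
  ∑-+ (suc n) f g = trans (cong (_+ (f n + g n)) (∑-+ n f g)) (interchange (∑ n f) (∑ n g) (f n) (g n))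

  ∑-*ˡ : ∀ n c f → ∑ n (λ k → c * f k) ≡ c * ∑ n f
  ∑-*ˡ zero    c f = sym (*-zeroʳ c)
  ∑-*ˡ (suc n) c f = trans (cong (_+ c * f n) (∑-*ˡ n c f)) (sym (*-distribˡ-+ c (∑ n f) (f n)))

  ∑-const : ∀ n c → ∑ n (λ _ → c) ≡ c * n
  ∑-const zero    c = sym (*-zeroʳ c)
  ∑-const (suc n) c = trans (cong (_+ c) (∑-const n c)) (trans (+-comm (c * n) c) (sym (*-suc c n)))

  ∑-swap : ∀ n m (f : ℕ → ℕ → ℕ) → ∑ n (λ a → ∑ m (f a)) ≡ ∑ m (λ b → ∑ n (λ a → f a b))
  ∑-swap zero    m f = sym (trans (∑-const m 0) (*-zeroˡ m))
  ∑-swap (suc n) m f = trans (cong (_+ ∑ m (f n)) (∑-swap n m f))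
                             (sym (∑-+ m (λ b → ∑ n (λ a → f a b)) (f n)))

  ∑-extend : ∀ {m n} f → m ≤ n → ∑ m f ≤ ∑ n f
  ∑-extend f m≤n = go (≤⇒≤′ m≤n)
    where
    go : ∀ {m n} → m ≤′ n → ∑ m f ≤ ∑ n f
    go ≤′-refl        = ≤-refl
    go (≤′-step m≤′n) = ≤-trans (go m≤′n) (m≤m+n _ _)

  𝟙-mono : ∀ {x y} → (T x → T y) → 𝟙 x ≤ 𝟙 y
  𝟙-mono {false} x⇒y = z≤n
  𝟙-mono {true} {true}  x⇒y = ≤-refl
  𝟙-mono {true} {false} x⇒y = contradiction tt x⇒y

  if-< : ∀ {A : Set} {a b} (x y : A) → a < b → (if a <ᵇ b then x else y) ≡ x
  if-< {a = a} {b} x y a<b with a <ᵇ b | <ᵇ-reflects-< a b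
  ... | true  | _        = refl
  ... | false | ofⁿ a≮b = contradiction a<b a≮b

  ∧-intro : ∀ x {y} → T x → T y → T (x ∧ y)
  ∧-intro true _ ty = ty

  ∧-elim : ∀ x {y} → T (x ∧ y) → T x × T y
  ∧-elim true ty = tt , ty

  xor-true : ∀ x r → T (x xor r) → T x → T (not r)
  xor-true true false _ _ = tt

  xor-false : ∀ x r → T (x xor r) → T (not x) → T r
  xor-false false true _ _ = tt

  not-<ᵇ : ∀ m n → T (not (m <ᵇ n)) → n ≤ m
  not-<ᵇ m n _ with m <ᵇ n | <ᵇ-reflects-< m n
  ... | false | ofⁿ m≮n = ≮⇒≥ m≮n

  -- One step of a greedy selection: a new marked position is selected only while
  -- fewer than k marked positions have been seen; this preserves the invariant
  -- "selected ≤ k and selected ≤ seen".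
  selection-step : ∀ {k sel seen} → sel ≤ k × sel ≤ seen → ∀ b →
    (sel + 𝟙 (b ∧ (seen <ᵇ k)) ≤ k) × (sel + 𝟙 (b ∧ (seen <ᵇ k)) ≤ seen + 𝟙 b)
  selection-step {k} {sel} {seen} (sel≤k , sel≤seen) false =
    subst (_≤ k) (sym (+-identityʳ sel)) sel≤k , +-monoˡ-≤ 0 sel≤seen
  selection-step {k} {sel} {seen} (sel≤k , sel≤seen) true with seen <ᵇ k | <ᵇ-reflects-< seen k
  ... | false | _ = subst (_≤ k) (sym (+-identityʳ sel)) sel≤k , +-mono-≤ sel≤seen z≤n
  ... | true  | ofʸ seen<k =
    ≤-trans (+-monoˡ-≤ 1 sel≤seen) (subst (_≤ k) (+-comm 1 seen) seen<k) , +-monoˡ-≤ 1 sel≤seen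

  selectedByPrefix : ℕ → ℕ → (ℕ → Bool) → ℕ
  selectedByPrefix k L P = ∑ L (λ b → 𝟙 (P b ∧ (∑ b (𝟙 ∘ P) <ᵇ k)))

  short-prefix-bound : ∀ k L P → selectedByPrefix k L P ≤ k
  short-prefix-bound k L P = proj₁ (invariant L)
    where
    invariant : ∀ L → selectedByPrefix k L P ≤ k × selectedByPrefix k L P ≤ ∑ L (𝟙 ∘ P)
    invariant zero    = z≤n , z≤n
    invariant (suc L) = selection-step (invariant L) (P L)

  suffixCount : ℕ → (ℕ → Bool) → ℕ → ℕ
  suffixCount L P b = ∑ L (λ b' → if b <ᵇ b' then 𝟙 (P b') else 0)

  selectedBySuffix : ℕ → ℕ → (ℕ → Bool) → ℕ
  selectedBySuffix k L P = ∑ L (λ b → 𝟙 (P b ∧ (suffixCount L P b <ᵇ k)))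

  selectedBySuffix-unfold : ∀ k L P →
    selectedBySuffix k (suc L) P ≡ 𝟙 (P 0 ∧ (∑ L (𝟙 ∘ P ∘ suc) <ᵇ k)) + selectedBySuffix k L (P ∘ suc)
  selectedBySuffix-unfold k L P =
    trans (∑-unfoldˡ L _)
          (cong₂ _+_ (cong (λ x → 𝟙 (P 0 ∧ (x <ᵇ k))) (∑-unfoldˡ L _))
                     (∑-cong L (λ b _ → cong (λ x → 𝟙 (P (suc b) ∧ (x <ᵇ k))) (∑-unfoldˡ L _))))

  short-suffix-bound : ∀ k L P → selectedBySuffix k L P ≤ k
  short-suffix-bound k L P = proj₁ (invariant L P)
    where
    invariant : ∀ L P → selectedBySuffix k L P ≤ k × selectedBySuffix k L P ≤ ∑ L (𝟙 ∘ P)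
    invariant zero    P = z≤n , z≤n
    invariant (suc L) P with selection-step (invariant L (P ∘ suc)) (P 0)
    ... | ≤k , ≤seen = subst (_≤ k) sel≡ ≤k , subst₂ _≤_ sel≡ seen≡ ≤seen
      where
      sel≡ : selectedBySuffix k L (P ∘ suc) + 𝟙 (P 0 ∧ (∑ L (𝟙 ∘ P ∘ suc) <ᵇ k)) ≡ selectedBySuffix k (suc L) P
      sel≡ = trans (+-comm (selectedBySuffix k L (P ∘ suc)) _) (sym (selectedBySuffix-unfold k L P))
      seen≡ : ∑ L (𝟙 ∘ P ∘ suc) + 𝟙 (P 0) ≡ ∑ (suc L) (𝟙 ∘ P)
      seen≡ = trans (+-comm (∑ L (𝟙 ∘ P ∘ suc)) (𝟙 (P 0))) (sym (∑-unfoldˡ L (𝟙 ∘ P)))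

  weighted-count : ∀ L m (h : ℕ → Bool) (w : ℕ → ℕ) →
    (∀ a → a < L → T (h a) → m ≤ w a) → m * ∑ L (𝟙 ∘ h) ≤ ∑ L w
  weighted-count L m h w heavy = subst (_≤ ∑ L w) (∑-*ˡ L m (𝟙 ∘ h)) (∑-mono L pointwise)
    where
    pointwise : ∀ a → a < L → m * 𝟙 (h a) ≤ w a
    pointwise a a<L with h a | heavy a a<L
    ... | true  | m≤w = subst (_≤ w a) (sym (*-identityʳ m)) (m≤w tt)
    ... | false | _   = subst (_≤ w a) (sym (*-zeroʳ m)) z≤n

  fewer-than : ∀ m c W → m * c ≤ W → W < m * m → c < m
  fewer-than m c W mc≤W W<mm = *-cancelˡ-< m c m (≤-<-trans mc≤W W<mm)

  -- Column lemma, weak form: if every marked position has weight > s and the total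
  -- weight at or after any marked position is below (s+1)², at most s positions are
  -- marked (apply the weight count from the first marked position on).
  few-marked-from : ∀ L s (h : ℕ → Bool) (w : ℕ → ℕ) →
    (∀ a → a < L → T (h a) → suc s ≤ w a) →
    (∀ a → a < L → T (h a) → ∑ L (λ a' → if a' <ᵇ a then 0 else w a') < suc s * suc s) →
    ∑ L (𝟙 ∘ h) ≤ s
  few-marked-from zero    s h w heavy cone = z≤n
  few-marked-from (suc L) s h w heavy cone with h 0 in h0 | cone 0 z<s
  ... | true  | cone₀ = s≤s⁻¹ (fewer-than (suc s) _ _ (weighted-count (suc L) (suc s) h w heavy) (cone₀ tt))
  ... | false | _     = subst (_≤ s) (sym drop-head)
      (few-marked-from L s (h ∘ suc) (w ∘ suc) (λ a a<L → heavy (suc a) (s<s a<L))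
                       (λ a a<L ha → subst (_< suc s * suc s)
                          (∑-unfoldˡ L (λ a' → if a' <ᵇ suc a then 0 else w a')) (cone (suc a) (s<s a<L) ha)))
    where
    drop-head : ∑ (suc L) (𝟙 ∘ h) ≡ ∑ L (𝟙 ∘ h ∘ suc)
    drop-head = trans (∑-unfoldˡ L (𝟙 ∘ h)) (cong (λ x → 𝟙 x + ∑ L (𝟙 ∘ h ∘ suc)) h0)

  -- Column lemma, strict form: if every marked position has weight > s and the total
  -- weight strictly before any marked position is below (s+1)², at most s+1 positions
  -- are marked (apply the weight count to the positions before the last marked one).
  few-marked-before : ∀ L s (h : ℕ → Bool) (w : ℕ → ℕ) →
    (∀ a → a < L → T (h a) → suc s ≤ w a) →
    (∀ a → a < L → T (h a) → ∑ L (λ a' → if a' <ᵇ a then w a' else 0) < suc s * suc s) →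
    ∑ L (𝟙 ∘ h) ≤ suc s
  few-marked-before zero    s h w heavy cone = z≤n
  few-marked-before (suc L) s h w heavy cone with h L | cone L ≤-refl
  ... | false | _ = subst (_≤ suc s) (sym (+-identityʳ _))
      (few-marked-before L s h w (λ a a<L → heavy a (m<n⇒m<1+n a<L))
        (λ a a<L ha → ≤-<-trans (m≤m+n _ _) (cone a (m<n⇒m<1+n a<L) ha)))
  ... | true  | coneL = subst (_≤ suc s) (+-comm 1 _)
      (fewer-than (suc s) _ _ (weighted-count L (suc s) h w (λ a a<L → heavy a (m<n⇒m<1+n a<L)))
                  (≤-<-trans before-L (coneL tt)))
    where
    before-L : ∑ L w ≤ ∑ (suc L) (λ a' → if a' <ᵇ L then w a' else 0)
    before-L = ≤-trans (≤-reflexive (∑-cong L (λ a' a'<L → sym (if-< (w a') 0 a'<L)))) (m≤m+n _ _)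

  count : ℕ → (ℕ → ℕ → Bool) → ℕ
  count n Q = ∑ n (λ a → ∑ n (λ b → 𝟙 (Q a b)))

  count-split : ∀ n (Q c : ℕ → ℕ → Bool) →
    count n Q ≡ count n (λ a b → Q a b ∧ c a b) + count n (λ a b → Q a b ∧ not (c a b))
  count-split n Q c =
    trans (∑-cong n (λ a _ → trans (∑-cong n (λ b _ → split (Q a b) (c a b))) (∑-+ n _ _))) (∑-+ n _ _)
    where
    split : ∀ x y → 𝟙 x ≡ 𝟙 (x ∧ y) + 𝟙 (x ∧ not y)
    split true  true  = refl
    split true  false = refl
    split false y     = refl

  count-by-rows : ∀ n k Q → (∀ a → a < n → ∑ n (λ b → 𝟙 (Q a b)) ≤ k) → count n Q ≤ k * n
  count-by-rows n k Q row = subst (count n Q ≤_) (∑-const n k) (∑-mono n row)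

  count-by-columns : ∀ n k Q → (∀ b → b < n → ∑ n (λ a → 𝟙 (Q a b)) ≤ k) → count n Q ≤ k * n
  count-by-columns n k Q column =
    subst₂ _≤_ (sym (∑-swap n n (λ a b → 𝟙 (Q a b)))) (∑-const n k) (∑-mono n column)

  count-none : ∀ n Q → (∀ a b → a < n → b < n → ¬ T (Q a b)) → count n Q ≡ 0
  count-none n Q none = ≤-antisym (≤-trans (count-by-rows n 0 Q row) (≤-reflexive (*-zeroˡ n))) z≤n
    where
    row : ∀ a → a < n → ∑ n (λ b → 𝟙 (Q a b)) ≤ 0
    row a a<n = ≤-trans (∑-mono n (λ b b<n → 𝟙-mono (none a b a<n b<n))) (≤-reflexive (trans (∑-const n 0) (*-zeroˡ n)))

  count-symmetric : ∀ n (Q : ℕ → ℕ → Bool) → (∀ a b → Q a b ≡ Q b a) →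
    count n Q ≤ count n (λ a b → (a ≤ᵇ b) ∧ Q a b) + count n (λ a b → (a ≤ᵇ b) ∧ Q a b)
  count-symmetric n Q sym-Q = begin
    count n Q                                     ≤⟨ covered-twice ⟩
    count n upper + count n (λ a b → upper b a)   ≡⟨ cong (count n upper +_) (∑-swap n n (λ a b → 𝟙 (upper b a))) ⟩
    count n upper + count n upper                 ∎
    where
    open ≤-Reasoning
    upper : ℕ → ℕ → Bool
    upper a b = (a ≤ᵇ b) ∧ Q a b
    -- each cell is counted at (a, b) or, below the diagonal, at its mirror image (b, a)
    covered : ∀ a b → 𝟙 (Q a b) ≤ 𝟙 (upper a b) + 𝟙 (upper b a)
    covered a b with a ≤ᵇ b | ≤ᵇ-reflects-≤ a b
    ... | true  | _        = m≤m+n _ _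
    ... | false | ofⁿ a≰b with b ≤ᵇ a | ≤ᵇ-reflects-≤ b a
    ...   | true  | _        = ≤-reflexive (cong 𝟙 (sym-Q a b))
    ...   | false | ofⁿ b≰a = contradiction (≰⇒≥ a≰b) b≰a
    covered-twice : count n Q ≤ count n upper + count n (λ a b → upper b a)
    covered-twice = ≤-trans (∑-mono n (λ a _ → ∑-mono n (λ b _ → covered a b)))
                           (≤-reflexive (trans (∑-cong n (λ a _ → ∑-+ n _ _)) (∑-+ n _ _)))

  long-prefix : ∀ s b (P : ℕ → Bool) → T (P b ∧ not (∑ b (𝟙 ∘ P) <ᵇ s)) → suc s ≤ ∑ (suc b) (𝟙 ∘ P)
  long-prefix s b P marked with P b
  ... | true = subst (suc s ≤_) (+-comm 1 _) (s≤s (not-<ᵇ _ s marked))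

  lowerCone : ℕ → (ℕ → ℕ → Bool) → ℕ → ℕ → ℕ
  lowerCone n S a b = ∑ n (λ a' → if a' <ᵇ a then 0 else ∑ (suc b) (λ b' → 𝟙 (S a' b')))

  -- If no lower-left cone of a cell of S holds (s+1)² cells, S has at most 2sn cells:
  -- the cells preceded in their row by fewer than s cells number at most s per row,
  -- the others weigh more than s and so number at most s per column.
  lower-staircase : ∀ n s (S : ℕ → ℕ → Bool) →
    (∀ a b → a < n → b < n → T (S a b) → lowerCone n S a b < suc s * suc s) →
    count n S ≤ s * n + s * n
  lower-staircase n s S cone = begin
    count n S                      ≡⟨ count-split n S short ⟩
    count n light + count n heavy  ≤⟨ +-mono-≤ (count-by-rows n s light (λ a _ → short-prefix-bound s n (S a)))
                                                (count-by-columns n s heavy column) ⟩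
    s * n + s * n                  ∎
    where
    open ≤-Reasoning
    short light heavy : ℕ → ℕ → Bool
    short a b = ∑ b (𝟙 ∘ S a) <ᵇ s
    light a b = S a b ∧ short a b
    heavy a b = S a b ∧ not (short a b)
    column : ∀ b → b < n → ∑ n (λ a → 𝟙 (heavy a b)) ≤ s
    column b b<n = few-marked-from n s (λ a → heavy a b) (λ a → ∑ (suc b) (𝟙 ∘ S a))
      (λ a _ → long-prefix s b (S a))
      (λ a a<n h → cone a b a<n b<n (proj₁ (∧-elim _ h)))

  upperCone : ℕ → (ℕ → ℕ → Bool) → ℕ → ℕ → ℕ
  upperCone n S a b = ∑ n (λ a' → if a' <ᵇ a then suffixCount n (S a') b else 0)

  -- If no strict upper-right cone of a cell of S holds (s+1)² cells, S has at most
  -- 2(s+1)n cells: the cells followed in their row by at most s cells number at most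
  -- s+1 per row, the others weigh more than s and so number at most s+1 per column.
  upper-staircase : ∀ n s (S : ℕ → ℕ → Bool) →
    (∀ a b → a < n → b < n → T (S a b) → upperCone n S a b < suc s * suc s) →
    count n S ≤ suc s * n + suc s * n
  upper-staircase n s S cone = begin
    count n S                      ≡⟨ count-split n S short ⟩
    count n light + count n heavy  ≤⟨ +-mono-≤ (count-by-rows n (suc s) light (λ a _ → short-suffix-bound (suc s) n (S a)))
                                                (count-by-columns n (suc s) heavy column) ⟩
    suc s * n + suc s * n          ∎
    where
    open ≤-Reasoning
    short light heavy : ℕ → ℕ → Bool
    short a b = suffixCount n (S a) b <ᵇ suc s
    light a b = S a b ∧ short a b
    heavy a b = S a b ∧ not (short a b)
    column : ∀ b → b < n → ∑ n (λ a → 𝟙 (heavy a b)) ≤ suc s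
    column b b<n = few-marked-before n s (λ a → heavy a b) (λ a → suffixCount n (S a) b)
      (λ a _ h → not-<ᵇ _ _ (proj₂ (∧-elim _ h)))
      (λ a a<n h → cone a b a<n b<n (proj₁ (∧-elim _ h)))

module Rationals where

  open import Defs using (ℕtoℚ)
  open import Data.Nat as ℕ using (ℕ; zero; suc; z≤n; _∸_)
  import Data.Nat.Properties as ℕ
  open import Data.Nat.Tactic.RingSolver using (solve-∀)
  open import Data.Integer as ℤ using (+_; -[1+_])
  import Data.Integer.Properties as ℤ
  open import Data.Nat.Coprimality using (1-coprimeTo; sym)
  open import Data.Rational
  open import Data.Rational.Properties
  open import Algebra.Properties.AbelianGroup +-0-abelianGroup using (xyx⁻¹≈y)
  open import Data.Product using (Σ-syntax; _×_; _,_)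
  open import Data.Sum using (_⊎_; inj₁; inj₂)
  open import Relation.Binary.PropositionalEquality using (_≡_; cong; cong₂; subst; subst₂)
    renaming (sym to ≡-sym; trans to ≡-trans)
  open import Relation.Nullary using (yes; no)

  ℕtoℚ-normal : ∀ k → ℕtoℚ k ≡ mkℚ (+ k) 0 (sym (1-coprimeTo k))
  ℕtoℚ-normal k = normalize-coprime (sym (1-coprimeTo k))

  ℕtoℚ-mono-≤ : ∀ {a b} → a ℕ.≤ b → ℕtoℚ a ≤ ℕtoℚ b
  ℕtoℚ-mono-≤ {a} {b} a≤b rewrite ℕtoℚ-normal a | ℕtoℚ-normal b =
    *≤* (subst₂ ℤ._≤_ (≡-sym (ℤ.*-identityʳ (+ a))) (≡-sym (ℤ.*-identityʳ (+ b))) (ℤ.+≤+ a≤b))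

  ℕtoℚ-cancel-< : ∀ {a b} → ℕtoℚ a < ℕtoℚ b → a ℕ.< b
  ℕtoℚ-cancel-< {a} {b} a<b rewrite ℕtoℚ-normal a | ℕtoℚ-normal b with a<b
  ... | *<* a*1<b*1 with subst₂ ℤ._<_ (ℤ.*-identityʳ (+ a)) (ℤ.*-identityʳ (+ b)) a*1<b*1
  ...   | ℤ.+<+ a<b′ = a<b′

  ℕtoℚ-+ : ∀ a b → ℕtoℚ a + ℕtoℚ b ≡ ℕtoℚ (a ℕ.+ b)
  ℕtoℚ-+ a b rewrite ℕtoℚ-normal a | ℕtoℚ-normal b =
    cong (_/ 1) (≡-trans (cong₂ ℤ._+_ (ℤ.*-identityʳ (+ a)) (ℤ.*-identityʳ (+ b))) (≡-sym (ℤ.pos-+ a b)))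

  ℕtoℚ-* : ∀ a b → ℕtoℚ a * ℕtoℚ b ≡ ℕtoℚ (a ℕ.* b)
  ℕtoℚ-* a b rewrite ℕtoℚ-normal a | ℕtoℚ-normal b = cong (_/ 1) (≡-sym (ℤ.pos-* a b))

  ℕtoℚ-∸ : ∀ {m d} → m ℕ.≤ d → ℕtoℚ d - ℕtoℚ m ≡ ℕtoℚ (d ∸ m)
  ℕtoℚ-∸ {m} {d} m≤d = begin-equality
    ℕtoℚ d - ℕtoℚ m                        ≡⟨ cong (λ k → ℕtoℚ k - ℕtoℚ m) (≡-sym (ℕ.m+[n∸m]≡n m≤d)) ⟩
    ℕtoℚ (m ℕ.+ (d ∸ m)) - ℕtoℚ m          ≡⟨ cong (_- ℕtoℚ m) (≡-sym (ℕtoℚ-+ m (d ∸ m))) ⟩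
    ℕtoℚ m + ℕtoℚ (d ∸ m) - ℕtoℚ m         ≡⟨ xyx⁻¹≈y (ℕtoℚ m) (ℕtoℚ (d ∸ m)) ⟩
    ℕtoℚ (d ∸ m)                           ∎
    where open ≤-Reasoning

  archimedean : ∀ t → Σ[ K ∈ ℕ ] t ≤ ℕtoℚ K
  archimedean t@(mkℚ (+ k) d _) = k , subst (t ≤_) (≡-sym (ℕtoℚ-normal k))
    (*≤* (subst₂ ℤ._≤_ (≡-sym (ℤ.*-identityʳ (+ k))) (ℤ.pos-* k (suc d)) (ℤ.+≤+ (ℕ.m≤m*n k (suc d)))))
  archimedean t@(mkℚ -[1+ k ] d _) = 0 , <⇒≤ (negative⁻¹ t)

  square-bracket : ∀ t → 0ℚ < t → Σ[ s ∈ ℕ ] (ℕtoℚ (s ℕ.* s) ≤ t) × (t ≤ ℕtoℚ (suc s ℕ.* suc s))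
  square-bracket t 0<t with archimedean t
  ... | K , t≤K = descend K (≤-trans t≤K (ℕtoℚ-mono-≤ (ℕ.≤-trans (ℕ.n≤1+n K) (ℕ.m≤m*n (suc K) (suc K)))))
    where
    descend : ∀ K → t ≤ ℕtoℚ (suc K ℕ.* suc K) → Σ[ s ∈ ℕ ] (ℕtoℚ (s ℕ.* s) ≤ t) × (t ≤ ℕtoℚ (suc s ℕ.* suc s))
    descend zero    t≤1 = 0 , <⇒≤ 0<t , t≤1
    descend (suc K) t≤  with t ≤? ℕtoℚ (suc K ℕ.* suc K)
    ... | yes t≤K² = descend K t≤K²
    ... | no  t≰K² = suc K , <⇒≤ (≰⇒> t≰K²) , t≤

  square-bound : ∀ d n s t → d ℕ.≤ 4 ℕ.* n ℕ.+ 8 ℕ.* s ℕ.* n → ℕtoℚ (s ℕ.* s) ≤ t →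
    (ℕtoℚ d ≤ ℕtoℚ 4 * ℕtoℚ n) ⊎
    ((ℕtoℚ d - ℕtoℚ 4 * ℕtoℚ n) * (ℕtoℚ d - ℕtoℚ 4 * ℕtoℚ n) ≤ ℕtoℚ 256 * ℕtoℚ n * ℕtoℚ n * t)
  square-bound d n s t d≤ s²≤t with d ℕ.≤? 4 ℕ.* n
  ... | yes d≤4n = inj₁ (subst (ℕtoℚ d ≤_) (≡-sym (ℕtoℚ-* 4 n)) (ℕtoℚ-mono-≤ d≤4n))
  ... | no  d≰4n = inj₂ (begin
    (ℕtoℚ d - ℕtoℚ 4 * ℕtoℚ n) * (ℕtoℚ d - ℕtoℚ 4 * ℕtoℚ n) ≡⟨ cong (λ y → y * y) excess ⟩
    ℕtoℚ x * ℕtoℚ x                                          ≡⟨ ℕtoℚ-* x x ⟩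
    ℕtoℚ (x ℕ.* x)                                           ≤⟨ ℕtoℚ-mono-≤ x²≤ ⟩
    ℕtoℚ (256 ℕ.* n ℕ.* n ℕ.* (s ℕ.* s))                     ≡⟨ ℕtoℚ-* (256 ℕ.* n ℕ.* n) (s ℕ.* s) ⟨
    ℕtoℚ (256 ℕ.* n ℕ.* n) * ℕtoℚ (s ℕ.* s)                  ≤⟨ *-monoˡ-≤-nonNeg (ℕtoℚ (256 ℕ.* n ℕ.* n)) s²≤t ⟩
    ℕtoℚ (256 ℕ.* n ℕ.* n) * t                               ≡⟨ cong (_* t) 256n² ⟨
    ℕtoℚ 256 * ℕtoℚ n * ℕtoℚ n * t                           ∎)
    where
    open ≤-Reasoning
    instance
      256n²-nonNeg : NonNegative (ℕtoℚ (256 ℕ.* n ℕ.* n))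
      256n²-nonNeg = nonNegative (ℕtoℚ-mono-≤ {0} {256 ℕ.* n ℕ.* n} z≤n)
    x : ℕ
    x = d ∸ 4 ℕ.* n
    4n≤d : 4 ℕ.* n ℕ.≤ d
    4n≤d = ℕ.<⇒≤ (ℕ.≰⇒> d≰4n)
    excess : ℕtoℚ d - ℕtoℚ 4 * ℕtoℚ n ≡ ℕtoℚ x
    excess = ≡-trans (cong (λ y → ℕtoℚ d - y) (ℕtoℚ-* 4 n)) (ℕtoℚ-∸ 4n≤d)
    x≤8sn : x ℕ.≤ 8 ℕ.* s ℕ.* n
    x≤8sn = ℕ.+-cancelˡ-≤ (4 ℕ.* n) x (8 ℕ.* s ℕ.* n) (subst (ℕ._≤ _) (≡-sym (ℕ.m+[n∸m]≡n 4n≤d)) d≤)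
    x²≤ : x ℕ.* x ℕ.≤ 256 ℕ.* n ℕ.* n ℕ.* (s ℕ.* s)
    x²≤ = ℕ.≤-trans (ℕ.*-mono-≤ x≤8sn x≤8sn)
            (subst₂ ℕ._≤_ (square s n) (scale s n) (ℕ.*-monoˡ-≤ (n ℕ.* n ℕ.* (s ℕ.* s)) (ℕ.≤ᵇ⇒≤ 64 256 _)))
      where
      square : ∀ s n → 64 ℕ.* (n ℕ.* n ℕ.* (s ℕ.* s)) ≡ (8 ℕ.* s ℕ.* n) ℕ.* (8 ℕ.* s ℕ.* n)
      square = solve-∀
      scale : ∀ s n → 256 ℕ.* (n ℕ.* n ℕ.* (s ℕ.* s)) ≡ 256 ℕ.* n ℕ.* n ℕ.* (s ℕ.* s)
      scale = solve-∀
    256n² : ℕtoℚ 256 * ℕtoℚ n * ℕtoℚ n ≡ ℕtoℚ (256 ℕ.* n ℕ.* n)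
    256n² = ≡-trans (cong (_* ℕtoℚ n) (ℕtoℚ-* 256 n)) (ℕtoℚ-* (256 ℕ.* n) n)

module MatrixErrors where

  open import Defs
  open import Data.Bool using (Bool; true; false; if_then_else_; _∧_; not; T; _xor_)
  open import Data.Nat
  open import Data.Nat.Properties
  open import Data.Nat.ListAction using (sum)
  open import Data.Nat.Tactic.RingSolver using (solve-∀)
  open import Data.Fin using (Fin; toℕ; fromℕ<) renaming (zero to fzero; suc to fsuc)
  open import Data.Fin.Properties using (toℕ<n; fromℕ<-toℕ)
  open import Data.List using (map; allFin; tabulate)
  open import Data.List.Properties using (map-tabulate)
  open import Data.Product using (_×_; _,_; proj₁; proj₂)
  open import Data.Sum using (_⊎_; inj₁; inj₂)
  open import Data.Empty using (⊥-elim)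
  open import Data.Rational using (ℚ) renaming (_≤_ to _≤ℚ_; _<_ to _<ℚ_)
  import Data.Rational.Properties as ℚ
  open import Function using (_∘_)
  open import Relation.Binary.PropositionalEquality
  open import Relation.Nullary using (¬_; Dec; does; yes; no; contradiction)
  open import Relation.Nullary.Reflects using (ofʸ; ofⁿ)
  open Counting
  open Rationals using (ℕtoℚ-cancel-<)

  sum-tabulate : ∀ n (g : Fin n → ℕ) (h : ℕ → ℕ) → (∀ i → g i ≡ h (toℕ i)) → sum (tabulate g) ≡ ∑ n h
  sum-tabulate zero    g h eq = refl
  sum-tabulate (suc n) g h eq =
    trans (cong₂ _+_ (eq fzero) (sum-tabulate n (g ∘ fsuc) (h ∘ suc) (eq ∘ fsuc))) (sym (∑-unfoldˡ n h))

  countCells≡count : ∀ n (P : Fin n → Fin n → Bool) (Q : ℕ → ℕ → Bool) →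
    (∀ i j → P i j ≡ Q (toℕ i) (toℕ j)) → countCells n P ≡ count n Q
  countCells≡count n P Q eq = sum-over-Fin _ _ (λ i → sum-over-Fin _ _ (λ j → cong 𝟙 (eq i j)))
    where
    sum-over-Fin : ∀ (g : Fin n → ℕ) (h : ℕ → ℕ) → (∀ i → g i ≡ h (toℕ i)) → sum (map g (allFin n)) ≡ ∑ n h
    sum-over-Fin g h eq′ = trans (cong sum (map-tabulate (λ i → i) g)) (sum-tabulate n g h eq′)

  decided : ∀ {P : Set} (d : Dec P) → T (does d) → P
  decided (yes p) _ = p

  refuted : ∀ {P : Set} (d : Dec P) → T (not (does d)) → ¬ P
  refuted (no ¬p) _ = ¬p

  module _ (n : ℕ) (A : BinMatrix n) (A-sym : Symmetric A) (t : ℚ) where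

    -- The matrix A as a function on ℕ × ℕ, zero outside [0, n)².
    entry : ℕ → ℕ → Bool
    entry a b with a <? n | b <? n
    ... | yes a<n | yes b<n = A (fromℕ< a<n) (fromℕ< b<n)
    ... | yes _   | no  _   = false
    ... | no  _   | _       = false

    entry-toℕ : ∀ i j → A i j ≡ entry (toℕ i) (toℕ j)
    entry-toℕ i j with toℕ i <? n | toℕ j <? n
    ... | yes i<n | yes j<n = sym (cong₂ A (fromℕ<-toℕ i i<n) (fromℕ<-toℕ j j<n))
    ... | yes _   | no  j≮n = contradiction (toℕ<n j) j≮n
    ... | no  i≮n | _       = contradiction (toℕ<n i) i≮n

    entry-sym : ∀ a b → entry a b ≡ entry b a
    entry-sym a b with a <? n | b <? n
    ... | yes a<n | yes b<n = A-sym (fromℕ< a<n) (fromℕ< b<n)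
    ... | yes _   | no  _   = refl
    ... | no  _   | yes _   = refl
    ... | no  _   | no  _   = refl

    oneUR≡count : ∀ I J → oneUR A I J ≡ count n (λ a b → (suc a <ᵇ I) ∧ (J <ᵇ suc b) ∧ entry a b)
    oneUR≡count I J =
      countCells≡count n _ _ (λ i j → cong (λ x → (suc (toℕ i) <ᵇ I) ∧ (J <ᵇ suc (toℕ j)) ∧ x) (entry-toℕ i j))

    zeroLL≡count : ∀ I J → zeroLL A I J ≡
      count n (λ a b → (I ≤ᵇ suc a) ∧ (suc a ≤ᵇ suc b) ∧ (suc b ≤ᵇ J) ∧ not (entry a b))
    zeroLL≡count I J = countCells≡count n _ _ (λ i j →
      cong (λ x → (I ≤ᵇ suc (toℕ i)) ∧ (suc (toℕ i) ≤ᵇ suc (toℕ j)) ∧ (suc (toℕ j) ≤ᵇ J) ∧ not x) (entry-toℕ i j))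

    oneUR-border : ∀ I J → I ≤ 1 ⊎ n ≤ J → oneUR A I J ≡ 0
    oneUR-border I J border = trans (oneUR≡count I J) (count-none n _ (outside border))
      where
      outside : I ≤ 1 ⊎ n ≤ J → ∀ a b → a < n → b < n → ¬ T ((suc a <ᵇ I) ∧ (J <ᵇ suc b) ∧ entry a b)
      outside (inj₁ I≤1) a b a<n b<n cell =
        <⇒≱ (<ᵇ⇒< _ _ (proj₁ (∧-elim (suc a <ᵇ I) cell))) (≤-trans I≤1 (s≤s z≤n))
      outside (inj₂ n≤J) a b a<n b<n cell =
        <⇒≱ (<ᵇ⇒< J (suc b) (proj₁ (∧-elim (J <ᵇ suc b) (proj₂ (∧-elim (suc a <ᵇ I) cell))))) (≤-trans b<n n≤J)

    R : ℕ → ℕ → Bool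
    R a b = Rupper A t (suc a ⊓ suc b) (suc a ⊔ suc b)

    R-sym : ∀ a b → R a b ≡ R b a
    R-sym a b = cong₂ (Rupper A t) (⊓-comm (suc a) (suc b)) (⊔-comm (suc a) (suc b))

    R-upper : ∀ {a b} → a ≤ b → R a b ≡ Rupper A t (suc a) (suc b)
    R-upper a≤b = cong₂ (Rupper A t) (m≤n⇒m⊓n≡m (s≤s a≤b)) (m≤n⇒m⊔n≡n (s≤s a≤b))

    Rupper-true : ∀ I J → T (Rupper A t I J) → 1 < I × J < n × t ≤ℚ ℕtoℚ (oneUR A I J)
    Rupper-true I J r with I ≤ᵇ 1 | ≤ᵇ-reflects-≤ I 1
    ... | true  | _        = ⊥-elim r
    ... | false | ofⁿ I≰1 with n ≤ᵇ J | ≤ᵇ-reflects-≤ n J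
    ...   | true  | _        = ⊥-elim r
    ...   | false | ofⁿ n≰J = ≰⇒> I≰1 , ≰⇒> n≰J , decided (t ℚ.≤? ℕtoℚ (oneUR A I J)) r

    Rupper-false : ∀ I J → T (not (Rupper A t I J)) → (I ≤ 1 ⊎ n ≤ J) ⊎ ℕtoℚ (oneUR A I J) <ℚ t
    Rupper-false I J r with I ≤ᵇ 1 | ≤ᵇ-reflects-≤ I 1
    ... | true  | ofʸ I≤1 = inj₁ (inj₁ I≤1)
    ... | false | _ with n ≤ᵇ J | ≤ᵇ-reflects-≤ n J
    ...   | true  | ofʸ n≤J = inj₁ (inj₂ n≤J)
    ...   | false | _        = inj₂ (ℚ.≰⇒> (refuted (t ℚ.≤? ℕtoℚ (oneUR A I J)) r))

    error : ℕ → ℕ → Bool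
    error a b = entry a b xor R a b

    errors≡count : diffCount A (Rmat A t) ≡ count n error
    errors≡count = countCells≡count n _ _ (λ i j → cong (_xor R (toℕ i) (toℕ j)) (entry-toℕ i j))

    upperError missed spurious : ℕ → ℕ → Bool
    upperError a b = (a ≤ᵇ b) ∧ error a b
    missed     a b = upperError a b ∧ entry a b
    spurious   a b = upperError a b ∧ not (entry a b)

    -- A and R are symmetric, so every error is mirrored by one on or above the diagonal.
    errors-by-upper : count n error ≤ (count n missed + count n spurious) + (count n missed + count n spurious)
    errors-by-upper = ≤-trans (count-symmetric n error error-sym) (≤-reflexive (cong₂ _+_ split split))
      where
      error-sym : ∀ a b → error a b ≡ error b a
      error-sym a b = cong₂ _xor_ (entry-sym a b) (R-sym a b)
      split : count n upperError ≡ count n missed + count n spurious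
      split = count-split n upperError entry

    upper-cell : ∀ a b → T (upperError a b) → a ≤ b × T (error a b)
    upper-cell a b up with ∧-elim (a ≤ᵇ b) up
    ... | a≤ᵇb , err = ≤ᵇ⇒≤ a b a≤ᵇb , err

    missed-cell : ∀ a b → T (missed a b) → a ≤ b × T (not (Rupper A t (suc a) (suc b)))
    missed-cell a b m with ∧-elim (upperError a b) m
    ... | up , e with upper-cell a b up
    ...   | a≤b , err = a≤b , subst (T ∘ not) (R-upper a≤b) (xor-true (entry a b) (R a b) err e)

    spurious-cell : ∀ a b → T (spurious a b) → a ≤ b × T (not (entry a b)) × T (Rupper A t (suc a) (suc b))
    spurious-cell a b sp with ∧-elim (upperError a b) sp
    ... | up , ¬e with upper-cell a b up
    ...   | a≤b , err = a≤b , ¬e , subst T (R-upper a≤b) (xor-false (entry a b) (R a b) err ¬e)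

    -- The cone of a missed cell consists of 1s of A in its upper-right region.
    missed-cone : ∀ a b → upperCone n missed a b ≤ oneUR A (suc a) (suc b)
    missed-cone a b = subst (upperCone n missed a b ≤_) (sym (oneUR≡count (suc a) (suc b))) (∑-mono n row)
      where
      row : ∀ a' → a' < n → (if a' <ᵇ a then suffixCount n (missed a') b else 0) ≤
                              ∑ n (λ b' → 𝟙 ((a' <ᵇ a) ∧ (b <ᵇ b') ∧ entry a' b'))
      row a' _ with a' <ᵇ a
      ... | false = z≤n
      ... | true  = ∑-mono n cell
        where
        cell : ∀ b' → b' < n → (if b <ᵇ b' then 𝟙 (missed a' b') else 0) ≤ 𝟙 ((b <ᵇ b') ∧ entry a' b')
        cell b' _ with b <ᵇ b'
        ... | false = z≤n
        ... | true  = 𝟙-mono (λ m → proj₂ (∧-elim (upperError a' b') m))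

    -- The cone of a spurious cell consists of 0s of A in its lower-left triangle.
    spurious-cone : ∀ a b → b < n → lowerCone n spurious a b ≤ zeroLL A (suc a) (suc b)
    spurious-cone a b b<n = subst (lowerCone n spurious a b ≤_) (sym (zeroLL≡count (suc a) (suc b))) (∑-mono n row)
      where
      row : ∀ a' → a' < n → (if a' <ᵇ a then 0 else ∑ (suc b) (λ b' → 𝟙 (spurious a' b'))) ≤
              ∑ n (λ b' → 𝟙 ((a <ᵇ suc a') ∧ (a' <ᵇ suc b') ∧ (b' <ᵇ suc b) ∧ not (entry a' b')))
      row a' _ with a' <ᵇ a | <ᵇ-reflects-< a' a
      ... | true  | _        = z≤n
      ... | false | ofⁿ a'≮a = ≤-trans (∑-mono (suc b) cell) (∑-extend _ b<n)
        where
        cell : ∀ b' → b' < suc b → 𝟙 (spurious a' b') ≤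
                 𝟙 ((a <ᵇ suc a') ∧ (a' <ᵇ suc b') ∧ (b' <ᵇ suc b) ∧ not (entry a' b'))
        cell b' b'≤b = 𝟙-mono λ sp → let (a'≤b' , ¬e , _) = spurious-cell a' b' sp in
          ∧-intro (a <ᵇ suc a') (<⇒<ᵇ (s≤s (≮⇒≥ a'≮a)))
            (∧-intro (a' <ᵇ suc b') (<⇒<ᵇ (s≤s a'≤b')) (∧-intro (b' <ᵇ suc b) (<⇒<ᵇ b'≤b) ¬e))

    module _ (s : ℕ) (t≤ : t ≤ℚ ℕtoℚ (suc s * suc s))
             (H : (i j : ℕ) → 1 ≤ i → i ≤ j → j ≤ n →
                  (ℕtoℚ (oneUR A i j) <ℚ t) ⊎ (ℕtoℚ (zeroLL A i j) <ℚ t)) where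

      below-square : ∀ c → ℕtoℚ c <ℚ t → c < suc s * suc s
      below-square c c<t = ℕtoℚ-cancel-< (ℚ.<-≤-trans c<t t≤)

      -- A missed cell lies on the border or has fewer than t ones in its upper-right region.
      missed-cone-small : ∀ a b → a < n → b < n → T (missed a b) → upperCone n missed a b < suc s * suc s
      missed-cone-small a b _ _ m =
        ≤-<-trans (missed-cone a b) (oneUR-small (Rupper-false (suc a) (suc b) (proj₂ (missed-cell a b m))))
        where
        oneUR-small : (suc a ≤ 1 ⊎ n ≤ suc b) ⊎ ℕtoℚ (oneUR A (suc a) (suc b)) <ℚ t →
                      oneUR A (suc a) (suc b) < suc s * suc s
        oneUR-small (inj₁ border) = subst (_< suc s * suc s) (sym (oneUR-border (suc a) (suc b) border)) z<s
        oneUR-small (inj₂ sparse) = below-square (oneUR A (suc a) (suc b)) sparse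

      -- A spurious cell has at least t ones in its upper-right region, hence by the
      -- hypothesis fewer than t zeros in its lower-left triangle.
      spurious-cone-small : ∀ a b → a < n → b < n → T (spurious a b) → lowerCone n spurious a b < suc s * suc s
      spurious-cone-small a b _ b<n sp =
        ≤-<-trans (spurious-cone a b b<n)
          (below-square (zeroLL A (suc a) (suc b))
            (sparse-triangle (H (suc a) (suc b) (s≤s z≤n) (s≤s a≤b) (<⇒≤ b+1<n))))
        where
        a≤b : a ≤ b
        a≤b = proj₁ (spurious-cell a b sp)
        dense : 1 < suc a × suc b < n × t ≤ℚ ℕtoℚ (oneUR A (suc a) (suc b))
        dense = Rupper-true (suc a) (suc b) (proj₂ (proj₂ (spurious-cell a b sp)))
        b+1<n : suc b < n
        b+1<n = proj₁ (proj₂ dense)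
        sparse-triangle : (ℕtoℚ (oneUR A (suc a) (suc b)) <ℚ t) ⊎ (ℕtoℚ (zeroLL A (suc a) (suc b)) <ℚ t) →
                          ℕtoℚ (zeroLL A (suc a) (suc b)) <ℚ t
        sparse-triangle (inj₁ UR<t) = ⊥-elim (ℚ.<-irrefl refl (ℚ.<-≤-trans UR<t (proj₂ (proj₂ dense))))
        sparse-triangle (inj₂ LL<t) = LL<t

      errors-bound : diffCount A (Rmat A t) ≤ 4 * n + 8 * s * n
      errors-bound = begin
        diffCount A (Rmat A t)                                                 ≡⟨ errors≡count ⟩
        count n error                                                          ≤⟨ errors-by-upper ⟩
        (count n missed + count n spurious) + (count n missed + count n spurious) ≤⟨ +-mono-≤ upper upper ⟩
        (2[s+1]n + 2sn) + (2[s+1]n + 2sn)                                      ≡⟨ arithmetic s n ⟩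
        4 * n + 8 * s * n                                                      ∎
        where
        open ≤-Reasoning
        2[s+1]n 2sn : ℕ
        2[s+1]n = suc s * n + suc s * n
        2sn     = s * n + s * n
        upper : count n missed + count n spurious ≤ 2[s+1]n + 2sn
        upper = +-mono-≤ (upper-staircase n s missed missed-cone-small)
                         (lower-staircase n s spurious spurious-cone-small)
        arithmetic : ∀ s n → ((suc s * n + suc s * n) + (s * n + s * n)) + ((suc s * n + suc s * n) + (s * n + s * n))
                             ≡ 4 * n + 8 * s * n
        arithmetic = solve-∀

open import Defs
open import Data.Nat using (ℕ) renaming (_≤_ to _≤ℕ_)
open import Data.Rational using (ℚ; _<_; _≤_; _*_; _-_; 0ℚ)
open import Data.Sum using (_⊎_)
open import Data.Product using (_,_)
open Rationals using (square-bracket; square-bound)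
open MatrixErrors using (errors-bound)

-- Choose s with s² ≤ t ≤ (s+1)²; then D ≤ 4n + 8sn ≤ 4n + 8√t·n, which is the claim
-- D ≤ 4n + 16√t·n written without square roots.
theorem3p1 : (n : ℕ) → 1 ≤ℕ n → (A : BinMatrix n) → Symmetric A →
    (t : ℚ) → 0ℚ < t →
    ((i j : ℕ) → 1 ≤ℕ i → i ≤ℕ j → j ≤ℕ n →
      (ℕtoℚ (oneUR A i j) < t) ⊎ (ℕtoℚ (zeroLL A i j) < t)) →
    let D = ℕtoℚ (diffCount A (Rmat A t))
        N = ℕtoℚ n
    in (D ≤ ℕtoℚ 4 * N) ⊎ ((D - ℕtoℚ 4 * N) * (D - ℕtoℚ 4 * N) ≤ ℕtoℚ 256 * N * N * t)
theorem3p1 n _ A A-sym t 0<t H =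
  let (s , s²≤t , t≤) = square-bracket t 0<t
  in  square-bound (diffCount A (Rmat A t)) n s t (errors-bound n A A-sym t s t≤ H) s²≤t
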